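{- For any connected graph $G$ and any integer $k\in\{1,2\}$, $$\left\lceil\frac{k\,\mathrm{diam}(G)+k}{3}\right\rceil\leq L_{k}(G).$$
   Context: All graphs are finite and simple; $N[v]$ denotes the closed neighborhood of a vertex $v$. For a positive integer $k$, a set $B\subseteq V(G)$ is a $k$-limited packing if $|N[v]\cap B|\le k$ for every $v\in V(G)$; the $k$-limited packing number $L_k(G)$ is the maximum size of a $k$-limited packing in $G$. $\mathrm{diam}(G)$ is the diameter of $G$. -}

module Defs where

open import Data.Nat using (ℕ; zero; suc; _+_; _*_; _≤_; _<_; _/_)
open import Data.Fin using (Fin)
open import Data.Fin.Subset using (Subset; _∩_; ∣_∣; _∈_)
open import Data.Bool using (Bool; true; false; _∨_)
open import Data.Vec using (tabulate)
open import Data.Product using (Σ; ∃; _×_)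
open import Relation.Nullary using (¬_)
open import Relation.Binary.PropositionalEquality using (_≡_)
open import Data.Fin.Subset using (Side; inside; outside)
open import Data.Fin using (_≟_)
open import Relation.Nullary.Decidable using (⌊_⌋)

record Graph (n : ℕ) : Set where
  field
    adj     : Fin n → Fin n → Bool
    symm    : ∀ u v → adj u v ≡ adj v u
    irrefl  : ∀ v → adj v v ≡ false
open Graph public

data Walk {n : ℕ} (G : Graph n) : Fin n → Fin n → ℕ → Set where
  here : ∀ {u} → Walk G u u 0
  step : ∀ {u w v ℓ} → adj G u w ≡ true → Walk G w v ℓ → Walk G u v (suc ℓ)

Connected : ∀ {n} → Graph n → Set
Connected G = ∀ u v → ∃ λ ℓ → Walk G u v ℓ

IsDist : ∀ {n} → Graph n → Fin n → Fin n → ℕ → Set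
IsDist G u v d = Walk G u v d × (∀ ℓ → Walk G u v ℓ → d ≤ ℓ)

IsDiam : ∀ {n} → Graph n → ℕ → Set
IsDiam {n} G D =
  (Σ (Fin n) λ u → Σ (Fin n) λ v → IsDist G u v D)
  × (∀ u v d → IsDist G u v d → d ≤ D)

toSide : Bool → Side
toSide true  = inside
toSide false = outside

N[_] : ∀ {n} {G : Graph n} → Fin n → Subset n
N[_] {G = G} v = tabulate λ u → toSide (⌊ u ≟ v ⌋ ∨ adj G v u)

closedNbhd : ∀ {n} → Graph n → Fin n → Subset n
closedNbhd G v = N[_] {G = G} v

IsLimitedPacking : ∀ {n} → Graph n → ℕ → Subset n → Set
IsLimitedPacking G k B = ∀ v → ∣ closedNbhd G v ∩ B ∣ ≤ k

IsLkNumber : ∀ {n} → Graph n → ℕ → ℕ → Set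
IsLkNumber G k L =
  (Σ _ λ B → IsLimitedPacking G k B × ∣ B ∣ ≡ L)
  × (∀ B → IsLimitedPacking G k B → ∣ B ∣ ≤ L)

⌈_/3⌉ : ℕ → ℕ
⌈ m /3⌉ = (m + 2) / 3

-- Take a shortest path x₀ x₁ … x_D between two vertices at distance
-- D = diam(G).  If x_i and x_j both lie in a closed neighbourhood N[w], they
-- are joined by a walk of length ≤ 2, so |i − j| ≤ 2 since the path is
-- shortest.  Choose the path vertices at the positions ⌊3t/k⌋ (t = 0, 1, …):
-- any k+1 consecutive chosen positions span more than 2, so every N[w] meets
-- at most k chosen vertices, and for k ≤ 3 the positions are distinct.  There
-- are exactly ⌈(kD + k)/3⌉ positions in [0, D], giving a k-limited packing of
-- that size.  The argument works for every k with 1 ≤ k ≤ 3.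
module Submission where

open import Defs
open import Data.Nat using (ℕ; zero; suc; _+_; _*_; _∸_; _≤_; _<_; _≤?_; z≤n; s≤s; _/_)
open import Data.Nat.Properties
open import Data.Nat.DivMod using (+-distrib-/-∣ˡ; m*n/n≡m; /-monoˡ-≤; m/n*n≤m; m<n*o⇒m/o<n)
open import Data.Nat.Divisibility using (divides-refl)
open import Data.Sum using (_⊎_; inj₁; inj₂)
open import Data.Product using (Σ; _×_; _,_)
open import Data.Fin using (Fin) renaming (_≟_ to _≟ᶠ_)
open import Data.Fin.Subset using (Subset; _∩_; _∪_; ∣_∣; _∈_; ⁅_⁆; _-_; ⊥; Empty; inside; outside)
open import Data.Fin.Subset.Properties
  using (_∈?_; ∣p∩q∣≤∣q∣; ∣⁅x⁆∣≡1; ∣⊥∣≡0; Empty-unique; x∈p∩q⁻; x∈⁅x⁆; x∈⁅y⁆⇒x≡y;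
         x∈p∪q⁺; ∩-distribˡ-∪; ∩-zeroʳ; x∈p⇒∣p-x∣<∣p∣; x∈p∧x≢y⇒x∈p-y)
open import Data.Bool using (true; false; _∨_)
open import Data.Vec using (_∷_; []; tabulate)
open import Data.Vec.Properties using ([]=⇒lookup; lookup∘tabulate)
open import Relation.Nullary using (Dec; yes; no; contradiction)
open import Relation.Nullary.Decidable using (⌊_⌋)
open import Relation.Unary using (Decidable)
open import Relation.Binary.Definitions using (tri<; tri≈; tri>)
open import Relation.Binary.PropositionalEquality

∣p∪q∣≤∣p∣+∣q∣ : ∀ {m} (p q : Subset m) → ∣ p ∪ q ∣ ≤ ∣ p ∣ + ∣ q ∣
∣p∪q∣≤∣p∣+∣q∣ []            []            = z≤n
∣p∪q∣≤∣p∣+∣q∣ (inside  ∷ p) (inside  ∷ q) = s≤s (≤-trans (∣p∪q∣≤∣p∣+∣q∣ p q) (+-monoʳ-≤ ∣ p ∣ (n≤1+n ∣ q ∣)))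
∣p∪q∣≤∣p∣+∣q∣ (inside  ∷ p) (outside ∷ q) = s≤s (∣p∪q∣≤∣p∣+∣q∣ p q)
∣p∪q∣≤∣p∣+∣q∣ (outside ∷ p) (inside  ∷ q) = ≤-trans (s≤s (∣p∪q∣≤∣p∣+∣q∣ p q)) (≤-reflexive (sym (+-suc ∣ p ∣ ∣ q ∣)))
∣p∪q∣≤∣p∣+∣q∣ (outside ∷ p) (outside ∷ q) = ∣p∪q∣≤∣p∣+∣q∣ p q

indicator : ∀ {A : Set} → Dec A → ℕ
indicator (yes _) = 1
indicator (no _)  = 0

∣p∩⁅x⁆∣≤[x∈p] : ∀ {m} (p : Subset m) x → ∣ p ∩ ⁅ x ⁆ ∣ ≤ indicator (x ∈? p)
∣p∩⁅x⁆∣≤[x∈p] {m} p x with x ∈? p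
... | yes _   = ≤-trans (∣p∩q∣≤∣q∣ p ⁅ x ⁆) (≤-reflexive (∣⁅x⁆∣≡1 x))
... | no  x∉p = ≤-reflexive (trans (cong ∣_∣ (Empty-unique disjoint)) (∣⊥∣≡0 m))
  where
    disjoint : Empty (p ∩ ⁅ x ⁆)
    disjoint (y , y∈p∩x) with x∈p∩q⁻ p ⁅ x ⁆ y∈p∩x
    ... | y∈p , y∈⁅x⁆ = x∉p (subst (_∈ p) (x∈⁅y⁆⇒x≡y x y∈⁅x⁆) y∈p)

image : ∀ {m} → (ℕ → Fin m) → ℕ → Subset m
image f zero    = ⊥
image f (suc n) = ⁅ f n ⁆ ∪ image f n

image-∋ : ∀ {m} (f : ℕ → Fin m) {n t} → t < n → f t ∈ image f n
image-∋ f {suc n} {t} t<1+n with m<1+n⇒m<n∨m≡n t<1+n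
... | inj₁ t<n  = x∈p∪q⁺ (inj₂ (image-∋ f t<n))
... | inj₂ refl = x∈p∪q⁺ (inj₁ (x∈⁅x⁆ (f t)))

injection-bound : ∀ {m} (f : ℕ → Fin m) (p : Subset m) n →
                  (∀ {s t} → s < n → t < n → f s ≡ f t → s ≡ t) →
                  (∀ {t} → t < n → f t ∈ p) → n ≤ ∣ p ∣
injection-bound f p zero    injective into = z≤n
injection-bound f p (suc n) injective into =
  ≤-<-trans (injection-bound f (p - f n) n injective′ into′) (x∈p⇒∣p-x∣<∣p∣ (into (n<1+n n)))
  where
    injective′ : ∀ {s t} → s < n → t < n → f s ≡ f t → s ≡ t
    injective′ s<n t<n = injective (m<n⇒m<1+n s<n) (m<n⇒m<1+n t<n)
    into′ : ∀ {t} → t < n → f t ∈ p - f n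
    into′ t<n = x∈p∧x≢y⇒x∈p-y (into (m<n⇒m<1+n t<n))
                  (λ ft≡fn → <⇒≢ t<n (injective (m<n⇒m<1+n t<n) (n<1+n n) ft≡fn))

count : ∀ {P : ℕ → Set} → Decidable P → ℕ → ℕ
count P? zero    = 0
count P? (suc n) = indicator (P? n) + count P? n

∣p∩image∣≤count : ∀ {m} (p : Subset m) (f : ℕ → Fin m) n →
                  ∣ p ∩ image f n ∣ ≤ count (λ t → f t ∈? p) n
∣p∩image∣≤count {m} p f zero    = ≤-reflexive (trans (cong ∣_∣ (∩-zeroʳ p)) (∣⊥∣≡0 m))
∣p∩image∣≤count     p f (suc n) = begin
  ∣ p ∩ (⁅ f n ⁆ ∪ image f n) ∣         ≡⟨ cong ∣_∣ (∩-distribˡ-∪ p ⁅ f n ⁆ (image f n)) ⟩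
  ∣ (p ∩ ⁅ f n ⁆) ∪ (p ∩ image f n) ∣   ≤⟨ ∣p∪q∣≤∣p∣+∣q∣ (p ∩ ⁅ f n ⁆) (p ∩ image f n) ⟩
  ∣ p ∩ ⁅ f n ⁆ ∣ + ∣ p ∩ image f n ∣   ≤⟨ +-mono-≤ (∣p∩⁅x⁆∣≤[x∈p] p (f n)) (∣p∩image∣≤count p f n) ⟩
  count (λ t → f t ∈? p) (suc n)        ∎
  where open ≤-Reasoning

count-window : ∀ {P : ℕ → Set} (P? : Decidable P) n c →
               (∀ {s} → s < n → P s → n ≤ s + c) → count P? n ≤ c
count-window P? zero    c       late = z≤n
count-window P? (suc n) c       late with P? n
count-window P? (suc n) zero    late | yes Pn =
  contradiction (subst (suc n ≤_) (+-identityʳ n) (late (n<1+n n) Pn)) 1+n≰n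
count-window P? (suc n) (suc c) late | yes Pn =
  s≤s (count-window P? n c (λ s<n Ps → ≤-pred (subst (suc n ≤_) (+-suc _ c) (late (m<n⇒m<1+n s<n) Ps))))
count-window P? (suc n) c       late | no _ =
  count-window P? n c (λ s<n Ps → ≤-trans (n≤1+n n) (late (m<n⇒m<1+n s<n) Ps))

-- Witnesses that are pairwise fewer than j+1 apart number at most j+1:
-- all of them lie within j of the last one.
count-cluster : ∀ {P : ℕ → Set} (P? : Decidable P) j n →
                (∀ {s t} → s < t → t < n → P s → P t → t ≤ s + j) → count P? n ≤ suc j
count-cluster P? j zero    close = z≤n
count-cluster P? j (suc n) close with P? n
... | yes Pn = s≤s (count-window P? n j (λ s<n Ps → close s<n (n<1+n n) Ps Pn))
... | no _   = count-cluster P? j n (λ s<t t<n → close s<t (m<n⇒m<1+n t<n))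

module ShortestWalks {m : ℕ} (G : Graph m) where

  IsShortest : Fin m → Fin m → ℕ → Set
  IsShortest u v ℓ = ∀ ℓ′ → Walk G u v ℓ′ → ℓ ≤ ℓ′

  _++_ : ∀ {u w v a b} → Walk G u w a → Walk G w v b → Walk G u v (a + b)
  here     ++ W = W
  step e V ++ W = step e (V ++ W)

  -- The i-th vertex of a walk (its endpoint once i exceeds the length).
  vertex : ∀ {u v ℓ} → Walk G u v ℓ → ℕ → Fin m
  vertex {u} here       i       = u
  vertex {u} (step _ W) zero    = u
  vertex     (step _ W) (suc i) = vertex W i

  prefix : ∀ {u v ℓ} (W : Walk G u v ℓ) i → i ≤ ℓ → Walk G u (vertex W i) i
  prefix here       zero    _         = here
  prefix (step e W) zero    _         = here
  prefix (step e W) (suc i) (s≤s i≤ℓ) = step e (prefix W i i≤ℓ)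

  suffix : ∀ {u v ℓ} (W : Walk G u v ℓ) i → i ≤ ℓ → Walk G (vertex W i) v (ℓ ∸ i)
  suffix here       zero    _         = here
  suffix (step e W) zero    _         = step e W
  suffix (step e W) (suc i) (s≤s i≤ℓ) = suffix W i i≤ℓ

  -- On a shortest walk, a walk of length c from the i-th to the j-th vertex
  -- forces j ≤ i + c: otherwise splicing it in would shorten the walk.
  shortcut : ∀ {u v ℓ} (W : Walk G u v ℓ) → IsShortest u v ℓ →
             ∀ {i j c} → i ≤ ℓ → j ≤ ℓ → Walk G (vertex W i) (vertex W j) c → j ≤ i + c
  shortcut {ℓ = ℓ} W shortest {i} {j} {c} i≤ℓ j≤ℓ V = +-cancelʳ-≤ (ℓ ∸ j) j (i + c) (begin
    j + (ℓ ∸ j)         ≡⟨ m+[n∸m]≡n j≤ℓ ⟩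
    ℓ                   ≤⟨ shortest _ (prefix W i i≤ℓ ++ (V ++ suffix W j j≤ℓ)) ⟩
    i + (c + (ℓ ∸ j))   ≡⟨ sym (+-assoc i c (ℓ ∸ j)) ⟩
    i + c + (ℓ ∸ j)     ∎)
    where open ≤-Reasoning

  shortest-injective : ∀ {u v ℓ} (W : Walk G u v ℓ) → IsShortest u v ℓ →
                       ∀ {i j} → i ≤ ℓ → j ≤ ℓ → vertex W i ≡ vertex W j → i ≡ j
  shortest-injective W shortest {i} {j} i≤ℓ j≤ℓ same = ≤-antisym
    (subst (i ≤_) (+-identityʳ j) (shortcut W shortest j≤ℓ i≤ℓ (subst (λ x → Walk G x (vertex W i) 0) same here)))
    (subst (j ≤_) (+-identityʳ i) (shortcut W shortest i≤ℓ j≤ℓ (subst (λ y → Walk G (vertex W i) y 0) same here)))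

  ∈N⇒≡∨adj : ∀ {x w} → x ∈ closedNbhd G w → x ≡ w ⊎ adj G w x ≡ true
  ∈N⇒≡∨adj {x} {w} x∈N = cases (x ≟ᶠ w) (adj G w x)
    (trans (sym (lookup∘tabulate (λ y → toSide (⌊ y ≟ᶠ w ⌋ ∨ adj G w y)) x)) ([]=⇒lookup x∈N))
    where
      cases : (d : Dec (x ≡ w)) → ∀ b → toSide (⌊ d ⌋ ∨ b) ≡ inside → x ≡ w ⊎ b ≡ true
      cases (yes x≡w) b     _  = inj₁ x≡w
      cases (no _)    true  _  = inj₂ refl
      cases (no _)    false ()

  nbhd-walk : ∀ {x y w} → x ∈ closedNbhd G w → y ∈ closedNbhd G w → Σ ℕ λ c → c ≤ 2 × Walk G x y c
  nbhd-walk x∈N y∈N with ∈N⇒≡∨adj x∈N | ∈N⇒≡∨adj y∈N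
  ... | inj₁ refl | inj₁ refl = 0 , z≤n , here
  ... | inj₁ refl | inj₂ wy   = 1 , s≤s z≤n , step wy here
  ... | inj₂ wx   | inj₁ refl = 1 , s≤s z≤n , step (trans (symm G _ _) wx) here
  ... | inj₂ wx   | inj₂ wy   = 2 , ≤-refl , step (trans (symm G _ _) wx) (step wy here)

  shortest-nbhd-gap : ∀ {u v ℓ} (W : Walk G u v ℓ) → IsShortest u v ℓ →
                      ∀ {w i j} → i ≤ ℓ → j ≤ ℓ →
                      vertex W i ∈ closedNbhd G w → vertex W j ∈ closedNbhd G w → j ≤ i + 2
  shortest-nbhd-gap W shortest {i = i} i≤ℓ j≤ℓ i∈N j∈N with nbhd-walk i∈N j∈N
  ... | c , c≤2 , V = ≤-trans (shortcut W shortest i≤ℓ j≤ℓ V) (+-monoʳ-≤ i c≤2)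

module Positions (j : ℕ) where

  k : ℕ
  k = suc j

  position : ℕ → ℕ
  position t = 3 * t / k

  position-gap : ∀ a s t → a * k + 3 * s ≤ 3 * t → a + position s ≤ position t
  position-gap a s t le = begin
    a + position s            ≡⟨ cong (_+ position s) (sym (m*n/n≡m a k)) ⟩
    a * k / k + 3 * s / k     ≡⟨ sym (+-distrib-/-∣ˡ (3 * s) (divides-refl a)) ⟩
    (a * k + 3 * s) / k       ≤⟨ /-monoˡ-≤ k le ⟩
    position t                ∎
    where open ≤-Reasoning

  position-cluster : ∀ s t → position t ≤ position s + 2 → t ≤ s + j
  position-cluster s t near with t ≤? s + j
  ... | yes t≤s+j = t≤s+j
  ... | no  t≰s+j = contradiction (≤-trans spread (subst (position t ≤_) (+-comm (position s) 2) near)) 1+n≰n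
    where
      far : s + k ≤ t
      far = subst (_≤ t) (sym (+-suc s j)) (≰⇒> t≰s+j)
      spread : 3 + position s ≤ position t
      spread = position-gap 3 s t (subst (_≤ 3 * t) (trans (*-distribˡ-+ 3 s k) (+-comm (3 * s) (3 * k)))
                                     (*-monoʳ-≤ 3 far))

  position-increasing : j ≤ 2 → ∀ {s t} → s < t → position s < position t
  position-increasing j≤2 {s} {t} s<t = position-gap 1 s t (begin
    1 * k + 3 * s   ≡⟨ cong (_+ 3 * s) (*-identityˡ k) ⟩
    k + 3 * s       ≤⟨ +-monoˡ-≤ (3 * s) (s≤s j≤2) ⟩
    3 + 3 * s       ≡⟨ sym (*-suc 3 s) ⟩
    3 * suc s       ≤⟨ *-monoʳ-≤ 3 s<t ⟩
    3 * t           ∎)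
    where open ≤-Reasoning

  position-injective : j ≤ 2 → ∀ s t → position s ≡ position t → s ≡ t
  position-injective j≤2 s t same with <-cmp s t
  ... | tri< s<t _ _ = contradiction same (<⇒≢ (position-increasing j≤2 s<t))
  ... | tri≈ _ s≡t _ = s≡t
  ... | tri> _ _ t<s = contradiction (sym same) (<⇒≢ (position-increasing j≤2 t<s))

  position-range : ∀ D {t} → t < ⌈ k * D + k /3⌉ → position t ≤ D
  position-range D {t} t<T = ≤-pred (m<n*o⇒m/o<n 3t<[1+D]k)
    where
      -- t + 1 ≤ ⌊(kD + k + 2)/3⌋ gives 3(t + 1) ≤ kD + k + 2, i.e. 3t < (D + 1)k.
      3[1+t]≤ : 3 * suc t ≤ k * D + k + 2
      3[1+t]≤ = ≤-trans (*-monoʳ-≤ 3 t<T) (subst (_≤ k * D + k + 2) (*-comm ⌈ k * D + k /3⌉ 3) (m/n*n≤m (k * D + k + 2) 3))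
      3t<[1+D]k : 3 * t < suc D * k
      3t<[1+D]k = subst (suc (3 * t) ≤_) (trans (+-comm (k * D) k) (cong (k +_) (*-comm k D)))
        (+-cancelʳ-≤ 2 (suc (3 * t)) (k * D + k)
          (subst (_≤ k * D + k + 2) (trans (*-suc 3 t) (+-comm 2 (suc (3 * t)))) 3[1+t]≤))

module PackingAlongShortestWalk {m : ℕ} (G : Graph m) {u v : Fin m} {D : ℕ} (W : Walk G u v D)
                                (shortest : ShortestWalks.IsShortest G u v D)
                                (j : ℕ) (j≤2 : j ≤ 2) where
  open ShortestWalks G
  open Positions j

  size : ℕ
  size = ⌈ k * D + k /3⌉

  chosen : ℕ → Fin m
  chosen t = vertex W (position t)

  packing : Subset m
  packing = image chosen size

  packing-size : size ≤ ∣ packing ∣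
  packing-size = injection-bound chosen packing size
    (λ {s} {t} s< t< same → position-injective j≤2 s t
       (shortest-injective W shortest (position-range D s<) (position-range D t<) same))
    (image-∋ chosen)

  -- Every N[w] meets at most k chosen vertices: their indices form a cluster.
  packing-limited : IsLimitedPacking G k packing
  packing-limited w = ≤-trans (∣p∩image∣≤count (closedNbhd G w) chosen size)
    (count-cluster (λ t → chosen t ∈? closedNbhd G w) j size
      (λ {s} {t} s<t t<T s∈N t∈N → position-cluster s t
        (shortest-nbhd-gap W shortest (position-range D (<-trans s<t t<T)) (position-range D t<T) s∈N t∈N)))

packing-number-bound : ∀ {m} (G : Graph m) {u v D} (W : Walk G u v D) →
                       ShortestWalks.IsShortest G u v D → ∀ j → j ≤ 2 → ∀ L →
                       (∀ B → IsLimitedPacking G (suc j) B → ∣ B ∣ ≤ L) →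
                       ⌈ suc j * D + suc j /3⌉ ≤ L
packing-number-bound G W shortest j j≤2 L maximal =
  ≤-trans packing-size (maximal packing packing-limited)
  where open PackingAlongShortestWalk G W shortest j j≤2

mainTheorem2 : ∀ (n : ℕ) (G : Graph (suc n)) → Connected G →
    ∀ (k : ℕ) → (k ≡ 1 ⊎ k ≡ 2) →
    ∀ (D L : ℕ) → IsDiam G D → IsLkNumber G k L →
    ⌈ k * D + k /3⌉ ≤ L
mainTheorem2 n G _ .1 (inj₁ refl) D L ((_ , _ , W , shortest) , _) (_ , maximal) =
  packing-number-bound G W shortest 0 z≤n L maximal
mainTheorem2 n G _ .2 (inj₂ refl) D L ((_ , _ , W , shortest) , _) (_ , maximal) =
  packing-number-bound G W shortest 1 (s≤s z≤n) L maximal
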